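{- Let $p$ be an odd prime and $s,n$ positive integers. For every integer $k$ with $0\le k\le\frac{p^n-1}{2}$, \[ p^{2sn}Z^{\mathrm{even}}_s(kp)\equiv p^{2s(n-1)}Z^{\mathrm{even}}_s(k)\pmod{p^n}. \]
   Context: $Z^{\mathrm{even}}_s(k)=(-1)^s\sum_{k>j_1>\cdots>j_s\ge0}\frac{1}{(j_1+\frac12)^2\cdots(j_s+\frac12)^2}$. For rationals $a,b$, $a\equiv b\pmod{p^n}$ means $a-b$ has $p$-adic valuation at least $n$. -}

module Defs where

open import Data.Nat as ℕ using (ℕ; zero; suc)
open import Data.Nat.Divisibility using (_∣_)
open import Data.Integer as ℤ using (+_; ∣_∣)
open import Data.Rational using (ℚ; _/_; _+_; _*_; _-_; -_; 0ℚ; 1ℚ; ↥_; ↧ₙ_)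
open import Data.Product using (_×_)
open import Relation.Nullary using (¬_)

-- 1 / (j + 1/2)^2 = 4 / (2j+1)^2
term : ℕ → ℚ
term j = + 4 / (suc (2 ℕ.* j) ℕ.* suc (2 ℕ.* j))

sumBelow : ℕ → (ℕ → ℚ) → ℚ
sumBelow zero    f = 0ℚ
sumBelow (suc k) f = sumBelow k f + f k

-- E s k = sum_{k > j_1 > ... > j_s >= 0} prod 1/(j_i + 1/2)^2
E : ℕ → ℕ → ℚ
E zero    k = 1ℚ
E (suc s) k = sumBelow k (λ j → term j * E s j)

sign : ℕ → ℚ → ℚ
sign zero    q = q
sign (suc s) q = - sign s q

Zeven : ℕ → ℕ → ℚ
Zeven s k = sign s (E s k)

-- a ≡ b (mod p^n) for rationals: v_p(a - b) ≥ n, i.e. for the reduced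
-- fraction of a - b, p^n divides the numerator and p does not divide
-- the denominator (for a - b = 0 the fraction is 0/1).
_≡_[modpow_^_] : ℚ → ℚ → ℕ → ℕ → Set
a ≡ b [modpow p ^ n ] = (p ℕ.^ n) ∣ ∣ ↥ (a - b) ∣ × ¬ (p ∣ ↧ₙ (a - b))

powℚ : ℕ → ℕ → ℚ
powℚ p m = + (p ℕ.^ m) / 1

-- With n fixed put D_s(m, c) = p^{2sn} E_s(m) - p^{2s(n-1)} E_s(c), where E_s is the unsigned sum,
-- and walk m from kp to (k+1)p one term at a time, keeping v_p(D_s(m, c)) ≥ n for every s;
-- c = k until m passes the odd multiple 2m+1 = p(2k+1), and c = k+1 afterwards.
-- Since E_{s+1}(m+1) = E_{s+1}(m) + E_s(m)/(m+1/2)^2, an ordinary step (p ∤ 2m+1) adds a p-adic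
-- unit times p^{2n} p^{2sn} E_s(m) = p^{2n} (D_s(m, c) + p^{2s(n-1)} E_s(c)), which is divisible
-- by p^n because p^{2s(n-1)} E_s(c) is p-integral (every 2j+1 < p^n has v_p(2j+1) ≤ n-1).
-- At the odd multiple both sides gain a term with the same p-integral factor
-- p^{2n}/(m+1/2)^2 = p^{2(n-1)}/(c+1/2)^2, and the two new terms combine into it times D_s(m, c).
module Submission where

open import Defs
open import Data.Nat using (ℕ; _≤_; _*_; _∸_; _^_; _/_; NonZero)
open import Data.Nat.Primality using (Prime)
open import Relation.Nullary using (¬_)
open import Relation.Binary.PropositionalEquality using (_≡_)
import Data.Rational

open import Data.Nat as ℕ using (zero; suc; _+_; _<_; z≤n; s≤s)
import Data.Nat.Properties as ℕ
open import Data.Nat.DivMod using (_%_; m%n<n; m≡m%n+[m/n]*n; m/n*n≤m)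
open import Data.Nat.Divisibility
  using (_∣_; _∣?_; divides; ∣-refl; 1∣_; m∣m*n; n∣m*n; ∣n⇒∣m*n; m*n∣⇒m∣; *-cancelˡ-∣; *-monoʳ-∣; ∣1⇒≡1; ∣⇒≤; ∣m+n∣m⇒∣n)
open import Data.Nat.Primality using (euclidsLemma; prime⇒nonTrivial; prime⇒irreducible)
import Data.Nat.Coprimality as Coprimality
open import Data.Nat.Induction using (<-rec)
open import Data.Nat.Tactic.RingSolver using (solve-∀)
open import Data.Integer as ℤ using (+_; ∣_∣)
import Data.Integer.Properties as ℤ
open import Data.Rational as ℚ using (ℚ; mkℚ; 0ℚ; toℚᵘ; fromℚᵘ; ↥_; ↧ₙ_)
import Data.Rational.Properties as ℚ
open import Data.Rational.Solver using (module +-*-Solver)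
open import Data.Rational.Unnormalised as ℚᵘ
  using (ℚᵘ; mkℚᵘ; *≡*) renaming (↧ₙ_ to ↧ₙᵘ_; _≃_ to _≃ᵘ_)
import Data.Rational.Unnormalised.Properties as ℚᵘP
import Data.Rational.Unnormalised.Solver as ℚᵘ-Solver
open import Data.Product using (Σ; _×_; _,_)
open import Data.Sum using ([_,_]′; inj₁; inj₂)
open import Data.Empty using (⊥-elim)
open import Relation.Nullary using (yes; no)
open import Relation.Binary.PropositionalEquality
  using (refl; sym; trans; cong; cong₂; subst; module ≡-Reasoning)

fromℚᵘ-* : ∀ x y → fromℚᵘ x ℚ.* fromℚᵘ y ≡ fromℚᵘ (x ℚᵘ.* y)
fromℚᵘ-* x y = ℚ.toℚᵘ-injective (ℚᵘP.≃-trans (ℚ.toℚᵘ-homo-* (fromℚᵘ x) (fromℚᵘ y))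
  (ℚᵘP.≃-trans (ℚᵘP.*-cong (ℚ.toℚᵘ-fromℚᵘ x) (ℚ.toℚᵘ-fromℚᵘ y)) (ℚᵘP.≃-sym (ℚ.toℚᵘ-fromℚᵘ (x ℚᵘ.* y)))))

/-*-/ : ∀ a b m n .{{_ : NonZero m}} .{{_ : NonZero n}} →
        (+ a ℚ./ m) ℚ.* (+ b ℚ./ n) ≡ (+ (a * b) ℚ./ (m * n)) {{ℕ.m*n≢0 m n}}
/-*-/ a b (suc d) (suc e) =
  trans (fromℚᵘ-* (mkℚᵘ (+ a) d) (mkℚᵘ (+ b) e)) (cong (λ i → i ℚ./ (suc d * suc e)) (sym (ℤ.pos-* a b)))

/-cross : ∀ a b m n .{{_ : NonZero m}} .{{_ : NonZero n}} → a * n ≡ b * m → + a ℚ./ m ≡ + b ℚ./ n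
/-cross a b (suc d) (suc e) eq =
  ℚ.fromℚᵘ-cong {mkℚᵘ (+ a) d} {mkℚᵘ (+ b) e}
    (*≡* (trans (sym (ℤ.pos-* a (suc e))) (trans (cong +_ eq) (ℤ.pos-* b (suc d)))))

powℚ-+ : ∀ p a b → powℚ p (a + b) ≡ powℚ p a ℚ.* powℚ p b
powℚ-+ p a b = sym (trans (/-*-/ (p ^ a) (p ^ b) 1 1)
  (/-cross (p ^ a * p ^ b) (p ^ (a + b)) 1 1 (cong (_* 1) (sym (ℕ.^-distribˡ-+-* p a b)))))

sign-linear : ∀ s x y u v → x ℚ.* sign s u ℚ.- y ℚ.* sign s v ≡ sign s (x ℚ.* u ℚ.- y ℚ.* v)
sign-linear zero    x y u v = refl
sign-linear (suc s) x y u v = trans (negate x y (sign s u) (sign s v)) (cong ℚ.-_ (sign-linear s x y u v))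
  where
  open +-*-Solver
  negate : ∀ x y u v → x ℚ.* ℚ.- u ℚ.- y ℚ.* ℚ.- v ≡ ℚ.- (x ℚ.* u ℚ.- y ℚ.* v)
  negate = solve 4 (λ x y u v → x :* (:- u) :- y :* (:- v) := :- (x :* u :- y :* v)) refl

m≤[n∸1]/2⇒2m<n : ∀ {k N} .{{_ : NonZero N}} → k ≤ (N ∸ 1) / 2 → 2 * k < N
m≤[n∸1]/2⇒2m<n {k} {suc N} k≤ =
  s≤s (ℕ.≤-trans (ℕ.*-monoʳ-≤ 2 k≤) (subst (_≤ N) (ℕ.*-comm (N / 2) 2) (m/n*n≤m N 2)))

prime≢2⇒odd : ∀ {p} → Prime p → ¬ p ≡ 2 → Σ ℕ λ h → p ≡ suc (2 * h)
prime≢2⇒odd {p} p-prime p≢2 with p % 2 | m%n<n p 2 | m≡m%n+[m/n]*n p 2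
... | zero        | _                 | p≡ =
  ⊥-elim ([ (λ ()) , (λ 2≡p → p≢2 (sym 2≡p)) ]′ (prime⇒irreducible p-prime (divides (p / 2) p≡)))
... | suc zero    | _                 | p≡ = p / 2 , trans p≡ (cong suc (ℕ.*-comm (p / 2) 2))
... | suc (suc _) | s≤s (s≤s ())    | _

module PAdic (p : ℕ) (p-prime : Prime p) where

  1<p : 1 < p
  1<p = ℕ.nonTrivial⇒n>1 p {{prime⇒nonTrivial p-prime}}

  instance
    p≢0 : NonZero p
    p≢0 = ℕ.>-nonZero (ℕ.<-trans ℕ.z<s 1<p)

  p∤1 : ¬ p ∣ 1
  p∤1 p∣1 = ℕ.<-irrefl (sym (∣1⇒≡1 p∣1)) 1<p

  p∤* : ∀ {a b} → ¬ p ∣ a → ¬ p ∣ b → ¬ p ∣ a * b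
  p∤* p∤a p∤b p∣ab = [ p∤a , p∤b ]′ (euclidsLemma _ _ p-prime p∣ab)

  p∤a*p+x : ∀ a x .{{_ : NonZero x}} → x < p → ¬ p ∣ a * p + x
  p∤a*p+x a x x<p p∣ = ℕ.<⇒≱ x<p (∣⇒≤ (∣m+n∣m⇒∣n p∣ (n∣m*n a)))

  p^m∣a*b⇒p^m∣a : ∀ m {a b} → ¬ p ∣ b → p ^ m ∣ a * b → p ^ m ∣ a
  p^m∣a*b⇒p^m∣a zero    {a} p∤b _ = 1∣ a
  p^m∣a*b⇒p^m∣a (suc m) {a} {b} p∤b p^[1+m]∣ab
    with euclidsLemma a b p-prime (m*n∣⇒m∣ p (p ^ m) p^[1+m]∣ab)
  ... | inj₂ p∣b = ⊥-elim (p∤b p∣b)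
  ... | inj₁ (divides q refl) = subst (p ^ suc m ∣_) (ℕ.*-comm p q) (*-monoʳ-∣ p p^m∣q)
    where
    regroup : ∀ q p b → q * p * b ≡ p * (q * b)
    regroup = solve-∀
    p^m∣q : p ^ m ∣ q
    p^m∣q = p^m∣a*b⇒p^m∣a m p∤b (*-cancelˡ-∣ p (subst (p ^ suc m ∣_) (regroup q p b) p^[1+m]∣ab))

  PAdicDecomposition : ℕ → Set
  PAdicDecomposition N = Σ ℕ λ e → Σ ℕ λ u → N ≡ p ^ e * u × ¬ p ∣ u

  p-adic-decomposition : ∀ N → 0 < N → PAdicDecomposition N
  p-adic-decomposition = <-rec _ decompose
    where
    decompose : ∀ N → (∀ {M} → M < N → 0 < M → PAdicDecomposition M) → 0 < N → PAdicDecomposition N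
    decompose N rec 0<N with p ∣? N
    ... | no p∤N = 0 , N , sym (ℕ.*-identityˡ N) , p∤N
    ... | yes (divides q refl)
      with rec (ℕ.m<m*n q p {{q≢0}} 1<p) (ℕ.n≢0⇒n>0 (ℕ.≢-nonZero⁻¹ q {{q≢0}}))
      where q≢0 = ℕ.m*n≢0⇒m≢0 q {{ℕ.>-nonZero 0<N}}
    ... | e , u , refl , p∤u = suc e , u , regroup (p ^ e) u p , p∤u
      where
      regroup : ∀ a u p → a * u * p ≡ p * a * u
      regroup = solve-∀

  pᵘ : ℕ → ℚᵘ
  pᵘ m = mkℚᵘ (+ (p ^ m)) 0

  pᵘ-+ : ∀ m k → pᵘ (m + k) ≃ᵘ pᵘ m ℚᵘ.* pᵘ k
  pᵘ-+ m k = *≡* (cong (ℤ._* + 1) (trans (cong +_ (ℕ.^-distribˡ-+-* p m k)) (ℤ.pos-* (p ^ m) (p ^ k))))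

  -- m ≤ᵥ q  says  m ≤ v_p(q).
  record _≤ᵥ_ (m : ℕ) (q : ℚ) : Set where
    constructor factorises
    field
      cofactor      : ℚᵘ
      p∤↧cofactor   : ¬ p ∣ ↧ₙᵘ cofactor
      factorisation : toℚᵘ q ≃ᵘ pᵘ m ℚᵘ.* cofactor

  infix 4 _≤ᵥ_

  open ℚᵘP using (≃-refl; ≃-sym; ≃-trans)

  ≤ᵥ-+ : ∀ {m q r} → m ≤ᵥ q → m ≤ᵥ r → m ≤ᵥ q ℚ.+ r
  ≤ᵥ-+ {m} {q} {r} (factorises u@record{} p∤u q≃) (factorises v@record{} p∤v r≃) =
    factorises (u ℚᵘ.+ v) (p∤* p∤u p∤v)
      (≃-trans (ℚ.toℚᵘ-homo-+ q r) (≃-trans (ℚᵘP.+-cong q≃ r≃) (≃-sym (ℚᵘP.*-distribˡ-+ (pᵘ m) u v))))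

  ≤ᵥ-* : ∀ {m k q r} → m ≤ᵥ q → k ≤ᵥ r → m + k ≤ᵥ q ℚ.* r
  ≤ᵥ-* {m} {k} {q} {r} (factorises u@record{} p∤u q≃) (factorises v@record{} p∤v r≃) =
    factorises (u ℚᵘ.* v) (p∤* p∤u p∤v)
      (≃-trans (ℚ.toℚᵘ-homo-* q r) (≃-trans (ℚᵘP.*-cong q≃ r≃)
        (≃-trans (regroup (pᵘ m) (pᵘ k) u v) (ℚᵘP.*-cong (≃-sym (pᵘ-+ m k)) ≃-refl))))
    where
    open ℚᵘ-Solver.+-*-Solver
    regroup : ∀ a b c d → (a ℚᵘ.* c) ℚᵘ.* (b ℚᵘ.* d) ≃ᵘ (a ℚᵘ.* b) ℚᵘ.* (c ℚᵘ.* d)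
    regroup = solve 4 (λ a b c d → (a :* c) :* (b :* d) := (a :* b) :* (c :* d)) ≃-refl

  ≤ᵥ-neg : ∀ {m q} → m ≤ᵥ q → m ≤ᵥ ℚ.- q
  ≤ᵥ-neg {m} {q} (factorises u@record{} p∤u q≃) =
    factorises (ℚᵘ.- u) p∤u
      (≃-trans (ℚ.toℚᵘ-homo‿- q) (≃-trans (ℚᵘP.-‿cong q≃) (ℚᵘP.neg-distribʳ-* (pᵘ m) u)))

  ≤ᵥ-weaken : ∀ {m k q} → m ≤ k → k ≤ᵥ q → m ≤ᵥ q
  ≤ᵥ-weaken {m} {k} m≤k (factorises u@record{} p∤u q≃) =
    factorises (pᵘ (k ∸ m) ℚᵘ.* u) (subst (λ d → ¬ p ∣ d) (sym (ℕ.*-identityˡ (↧ₙᵘ u))) p∤u)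
      (≃-trans q≃ (≃-trans (ℚᵘP.*-cong (ℚᵘP.≃-reflexive (cong pᵘ (sym (ℕ.m+[n∸m]≡n m≤k)))) ≃-refl)
        (≃-trans (ℚᵘP.*-cong (pᵘ-+ m (k ∸ m)) ≃-refl) (ℚᵘP.*-assoc (pᵘ m) (pᵘ (k ∸ m)) u))))

  ≤ᵥ-sign : ∀ s {m q} → m ≤ᵥ q → m ≤ᵥ sign s q
  ≤ᵥ-sign zero    m≤q = m≤q
  ≤ᵥ-sign (suc s) m≤q = ≤ᵥ-neg (≤ᵥ-sign s m≤q)

  ≤ᵥ-0ℚ : ∀ {m} → m ≤ᵥ 0ℚ
  ≤ᵥ-0ℚ {m} = factorises ℚᵘ.0ℚᵘ p∤1 (≃-sym (ℚᵘP.*-zeroʳ (pᵘ m)))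

  ≤ᵥ-powℚ : ∀ m → m ≤ᵥ powℚ p m
  ≤ᵥ-powℚ m = factorises ℚᵘ.1ℚᵘ p∤1 (≃-trans (ℚ.toℚᵘ-fromℚᵘ (pᵘ m)) (≃-sym (ℚᵘP.*-identityʳ (pᵘ m))))

  ≤ᵥ-/ : ∀ a n .{{_ : NonZero n}} → ¬ p ∣ n → 0 ≤ᵥ + a ℚ./ n
  ≤ᵥ-/ a (suc d) p∤n = factorises (mkℚᵘ (+ a) d) p∤n
    (≃-trans (ℚ.toℚᵘ-fromℚᵘ (mkℚᵘ (+ a) d)) (≃-sym (ℚᵘP.*-identityˡ (mkℚᵘ (+ a) d))))

  ≤ᵥ⇒p^m∣↥×p∤↧ : ∀ {m q} → m ≤ᵥ q → p ^ m ∣ ∣ ↥ q ∣ × ¬ p ∣ ↧ₙ q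
  ≤ᵥ⇒p^m∣↥×p∤↧ {m} {mkℚ num den coprime} (factorises (mkℚᵘ a b) p∤b (*≡* eq)) = p^m∣num , p∤den
    where
    cross : ∣ num ∣ * suc b ≡ p ^ m * (∣ a ∣ * suc den)
    cross = begin
      ∣ num ∣ * suc b                       ≡⟨ cong (λ d → ∣ num ∣ * suc d) (sym (ℕ.+-identityʳ b)) ⟩
      ∣ num ∣ * suc (b + 0)                 ≡⟨ sym (ℤ.abs-* num _) ⟩
      ∣ num ℤ.* + suc (b + 0) ∣             ≡⟨ cong ∣_∣ eq ⟩
      ∣ + (p ^ m) ℤ.* a ℤ.* + suc den ∣     ≡⟨ ℤ.abs-* (+ (p ^ m) ℤ.* a) _ ⟩
      ∣ + (p ^ m) ℤ.* a ∣ * suc den         ≡⟨ cong (_* suc den) (ℤ.abs-* (+ (p ^ m)) a) ⟩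
      p ^ m * ∣ a ∣ * suc den               ≡⟨ ℕ.*-assoc (p ^ m) ∣ a ∣ (suc den) ⟩
      p ^ m * (∣ a ∣ * suc den)             ∎
      where open ≡-Reasoning
    p^m∣num : p ^ m ∣ ∣ num ∣
    p^m∣num = p^m∣a*b⇒p^m∣a m p∤b (subst (p ^ m ∣_) (sym cross) (m∣m*n _))
    p∤den : ¬ p ∣ suc den
    p∤den p∣den with euclidsLemma ∣ num ∣ (suc b) p-prime
                       (subst (p ∣_) (sym cross) (∣n⇒∣m*n (p ^ m) (∣n⇒∣m*n ∣ a ∣ p∣den)))
    ... | inj₁ p∣num = p∤1 (subst (p ∣_) (Coprimality.recompute coprime (p∣num , p∣den)) ∣-refl)
    ... | inj₂ p∣b   = p∤b p∣b

scaled-E-suc : ∀ {z} x y s m → z ≡ x ℚ.* y →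
               z ℚ.* E (suc s) (suc m) ≡ z ℚ.* E (suc s) m ℚ.+ (x ℚ.* term m) ℚ.* (y ℚ.* E s m)
scaled-E-suc x y s m refl = distribute x y (E (suc s) m) (term m) (E s m)
  where
  open +-*-Solver
  distribute : ∀ x y e t f → (x ℚ.* y) ℚ.* (e ℚ.+ t ℚ.* f) ≡ (x ℚ.* y) ℚ.* e ℚ.+ (x ℚ.* t) ℚ.* (y ℚ.* f)
  distribute = solve 5 (λ x y e t f → (x :* y) :* (e :+ t :* f) := (x :* y) :* e :+ (x :* t) :* (y :* f)) refl

module Recurrence (p : ℕ) (p-prime : Prime p) where
  open PAdic p p-prime

  ≤ᵥ-term : ∀ j → ¬ p ∣ suc (2 * j) → 0 ≤ᵥ term j
  ≤ᵥ-term j p∤ = ≤ᵥ-/ 4 (suc (2 * j) * suc (2 * j)) (p∤* p∤ p∤)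

  -- v_p(2j+1) ≤ k, so p^{2k} cancels the p-part of (2j+1)^2.
  ≤ᵥ-powℚ*term : ∀ k j → suc (2 * j) < p ^ suc k → 0 ≤ᵥ powℚ p (2 * k) ℚ.* term j
  ≤ᵥ-powℚ*term k j N<p^[1+k] with p-adic-decomposition (suc (2 * j)) ℕ.z<s
  ... | e , zero    , _  , p∤0 = ⊥-elim (p∤0 (divides 0 refl))
  ... | e , suc u-1 , N≡ , p∤u =
    subst (0 ≤ᵥ_) (sym quotient) (≤ᵥ-/ (p ^ r * p ^ r * 4) (u * u) (p∤* p∤u p∤u))
    where
    N = suc (2 * j)
    u = suc u-1
    e≤k : e ≤ k
    e≤k = ℕ.≮⇒≥ λ k<e → ℕ.<⇒≱ N<p^[1+k]
      (ℕ.≤-trans (ℕ.^-monoʳ-≤ p k<e) (ℕ.≤-trans (ℕ.m≤m*n (p ^ e) u) (ℕ.≤-reflexive (sym N≡))))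
    r = k ∸ e
    p^k≡ : p ^ k ≡ p ^ e * p ^ r
    p^k≡ = trans (cong (p ^_) (sym (ℕ.m+[n∸m]≡n e≤k))) (ℕ.^-distribˡ-+-* p e r)
    p^2k≡ : p ^ (2 * k) ≡ (p ^ e * p ^ r) * (p ^ e * p ^ r)
    p^2k≡ = trans (ℕ.^-distribˡ-+-* p k (k + 0))
      (cong₂ _*_ p^k≡ (trans (cong (p ^_) (ℕ.+-identityʳ k)) p^k≡))
    regroup : ∀ a b u → a * b * (a * b) * 4 * (u * u) ≡ b * b * 4 * (1 * (a * u * (a * u)))
    regroup = solve-∀
    cross : p ^ (2 * k) * 4 * (u * u) ≡ p ^ r * p ^ r * 4 * (1 * (N * N))
    cross = begin
      p ^ (2 * k) * 4 * (u * u)                        ≡⟨ cong (λ x → x * 4 * (u * u)) p^2k≡ ⟩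
      p ^ e * p ^ r * (p ^ e * p ^ r) * 4 * (u * u)    ≡⟨ regroup (p ^ e) (p ^ r) u ⟩
      p ^ r * p ^ r * 4 * (1 * (p ^ e * u * (p ^ e * u)))
                                                       ≡⟨ cong (λ x → p ^ r * p ^ r * 4 * (1 * (x * x))) (sym N≡) ⟩
      p ^ r * p ^ r * 4 * (1 * (N * N))                ∎
      where open ≡-Reasoning
    quotient : powℚ p (2 * k) ℚ.* term j ≡ + (p ^ r * p ^ r * 4) ℚ./ (u * u)
    quotient = trans (/-*-/ (p ^ (2 * k)) 4 1 (N * N))
      (/-cross (p ^ (2 * k) * 4) (p ^ r * p ^ r * 4) (1 * (N * N)) (u * u) cross)

  term-at-p-multiple : ∀ {m c} → suc (2 * m) ≡ p * suc (2 * c) → term c ≡ term m ℚ.* powℚ p 2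
  term-at-p-multiple {m} {c} 2m+1≡ =
    sym (trans (/-*-/ 4 (p ^ 2) (suc (2 * m) * suc (2 * m)) 1) (/-cross (4 * p ^ 2) 4 _ _ cross))
    where
    regroup : ∀ q x → 4 * (q * (q * 1)) * (x * x) ≡ 4 * (q * x * (q * x) * 1)
    regroup = solve-∀
    cross : 4 * p ^ 2 * (suc (2 * c) * suc (2 * c)) ≡ 4 * (suc (2 * m) * suc (2 * m) * 1)
    cross = trans (regroup p (suc (2 * c))) (cong (λ x → 4 * (x * x * 1)) (sym 2m+1≡))

  powℚ-2*suc : ∀ t s → powℚ p (2 * suc s * t) ≡ powℚ p (2 * 1 * t) ℚ.* powℚ p (2 * s * t)
  powℚ-2*suc t s = trans (cong (powℚ p) (split s t)) (powℚ-+ p (2 * 1 * t) (2 * s * t))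
    where
    split : ∀ s t → 2 * suc s * t ≡ 2 * 1 * t + 2 * s * t
    split = solve-∀

  module Scaled (n-1 : ℕ) where

    n : ℕ
    n = suc n-1

    α β : ℕ → ℚ
    α s = powℚ p (2 * s * n)
    β s = powℚ p (2 * s * n-1)

    α₁≡p²β₁ : α 1 ≡ powℚ p 2 ℚ.* β 1
    α₁≡p²β₁ = trans (cong (powℚ p) (split n-1)) (powℚ-+ p 2 (2 * 1 * n-1))
      where
      split : ∀ k → 2 * 1 * suc k ≡ 2 + 2 * 1 * k
      split = solve-∀

    D : ℕ → ℕ → ℕ → ℚ
    D s m c = α s ℚ.* E s m ℚ.- β s ℚ.* E s c

    Congruent : ℕ → ℕ → Set
    Congruent m c = ∀ s → n ≤ᵥ D s m c

    ≤ᵥ-βE : ∀ c → 2 * c < p ^ n → ∀ s → 0 ≤ᵥ β s ℚ.* E s c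
    -- β 0 and E 0 c are 1ℚ, which is powℚ p 0.
    ≤ᵥ-βE c       _         zero    = ≤ᵥ-* (≤ᵥ-powℚ 0) (≤ᵥ-powℚ 0)
    ≤ᵥ-βE zero    _         (suc s) = subst (0 ≤ᵥ_) (sym (ℚ.*-zeroʳ (β (suc s)))) ≤ᵥ-0ℚ
    ≤ᵥ-βE (suc c) 2[c+1]<p^n (suc s) =
      subst (0 ≤ᵥ_) (sym (scaled-E-suc (β 1) (β s) s c (powℚ-2*suc n-1 s)))
        (≤ᵥ-+ (≤ᵥ-βE c 2c<p^n (suc s)) (≤ᵥ-* (≤ᵥ-powℚ*term n-1 c 2c+1<p^n) (≤ᵥ-βE c 2c<p^n s)))
      where
      2c+1<p^n : suc (2 * c) < p ^ n
      2c+1<p^n = ℕ.<-trans (ℕ.n<1+n _) (subst (_< p ^ n) (ℕ.*-suc 2 c) 2[c+1]<p^n)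
      2c<p^n : 2 * c < p ^ n
      2c<p^n = ℕ.<-trans (ℕ.n<1+n _) 2c+1<p^n

    -- D 0 m c is 1 · 1 - 1 · 1, which computes to 0ℚ.
    congruent-order-0 : ∀ m c → n ≤ᵥ D 0 m c
    congruent-order-0 m c = ≤ᵥ-0ℚ

    D-suc : ∀ s m c → D (suc s) (suc m) c ≡ D (suc s) m c ℚ.+ (α 1 ℚ.* term m) ℚ.* (α s ℚ.* E s m)
    D-suc s m c =
      trans (cong (ℚ._- β (suc s) ℚ.* E (suc s) c) (scaled-E-suc (α 1) (α s) s m (powℚ-2*suc n s)))
      (swap (α (suc s) ℚ.* E (suc s) m) ((α 1 ℚ.* term m) ℚ.* (α s ℚ.* E s m)) (β (suc s) ℚ.* E (suc s) c))
      where
      open +-*-Solver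
      swap : ∀ x y z → x ℚ.+ y ℚ.- z ≡ (x ℚ.- z) ℚ.+ y
      swap = solve 3 (λ x y z → x :+ y :- z := (x :- z) :+ y) refl

    D-suc-suc : ∀ s {m c} → suc (2 * m) ≡ p * suc (2 * c) →
                D (suc s) (suc m) (suc c) ≡ D (suc s) m c ℚ.+ (β 1 ℚ.* term c) ℚ.* D s m c
    D-suc-suc s {m} {c} 2m+1≡ = begin
      D (suc s) (suc m) (suc c)
        ≡⟨ cong₂ ℚ._-_ (scaled-E-suc (α 1) (α s) s m (powℚ-2*suc n s))
                       (scaled-E-suc (β 1) (β s) s c (powℚ-2*suc n-1 s)) ⟩
      (X ℚ.+ (α 1 ℚ.* term m) ℚ.* U) ℚ.- (Y ℚ.+ K ℚ.* V)
        ≡⟨ cong (λ x → (X ℚ.+ x ℚ.* U) ℚ.- (Y ℚ.+ K ℚ.* V)) same-factor ⟩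
      (X ℚ.+ K ℚ.* U) ℚ.- (Y ℚ.+ K ℚ.* V)
        ≡⟨ factor X Y K U V ⟩
      (X ℚ.- Y) ℚ.+ K ℚ.* (U ℚ.- V)
        ∎
      where
      open ≡-Reasoning
      open +-*-Solver
      X = α (suc s) ℚ.* E (suc s) m
      Y = β (suc s) ℚ.* E (suc s) c
      U = α s ℚ.* E s m
      V = β s ℚ.* E s c
      K = β 1 ℚ.* term c
      factor : ∀ x y z u v → (x ℚ.+ z ℚ.* u) ℚ.- (y ℚ.+ z ℚ.* v) ≡ (x ℚ.- y) ℚ.+ z ℚ.* (u ℚ.- v)
      factor = solve 5 (λ x y z u v → (x :+ z :* u) :- (y :+ z :* v) := (x :- y) :+ z :* (u :- v)) refl
      commute : ∀ x y z → x ℚ.* y ℚ.* z ≡ y ℚ.* (z ℚ.* x)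
      commute = solve 3 (λ x y z → x :* y :* z := y :* (z :* x)) refl
      same-factor : α 1 ℚ.* term m ≡ K
      same-factor = begin
        α 1 ℚ.* term m                    ≡⟨ cong (ℚ._* term m) α₁≡p²β₁ ⟩
        powℚ p 2 ℚ.* β 1 ℚ.* term m       ≡⟨ commute (powℚ p 2) (β 1) (term m) ⟩
        β 1 ℚ.* (term m ℚ.* powℚ p 2)     ≡⟨ cong (β 1 ℚ.*_) (sym (term-at-p-multiple {m} {c} 2m+1≡)) ⟩
        β 1 ℚ.* term c                    ∎

    congruent-step-p∤ : ∀ {m c} → ¬ p ∣ suc (2 * m) → (∀ s → 0 ≤ᵥ β s ℚ.* E s c) →
                        Congruent m c → Congruent (suc m) c
    congruent-step-p∤ {m} {c} p∤ βE-integral congruent zero    = congruent-order-0 (suc m) c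
    congruent-step-p∤ {m} {c} p∤ βE-integral congruent (suc s) = subst (n ≤ᵥ_) (sym (D-suc s m c))
      (≤ᵥ-+ (congruent (suc s))
            (≤ᵥ-weaken n≤2n (≤ᵥ-* (≤ᵥ-* (≤ᵥ-powℚ (2 * 1 * n)) (≤ᵥ-term m p∤)) αE-integral)))
      where
      n≤2n : n ≤ 2 * 1 * n + 0 + 0
      n≤2n = ℕ.≤-trans (ℕ.m≤m+n n (n + 0)) (ℕ.≤-trans (ℕ.m≤m+n _ 0) (ℕ.m≤m+n _ 0))
      split : ∀ x y → x ≡ (x ℚ.- y) ℚ.+ y
      split = solve 2 (λ x y → x := (x :- y) :+ y) refl
        where open +-*-Solver
      αE-integral : 0 ≤ᵥ α s ℚ.* E s m
      αE-integral = subst (0 ≤ᵥ_) (sym (split (α s ℚ.* E s m) (β s ℚ.* E s c)))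
        (≤ᵥ-+ (≤ᵥ-weaken z≤n (congruent s)) (βE-integral s))

    congruent-step-p∣ : ∀ {m c} → suc (2 * m) ≡ p * suc (2 * c) → suc (2 * c) < p ^ n →
                        Congruent m c → Congruent (suc m) (suc c)
    congruent-step-p∣ {m} {c} 2m+1≡ _         congruent zero    = congruent-order-0 (suc m) (suc c)
    congruent-step-p∣ {m} {c} 2m+1≡ 2c+1<p^n congruent (suc s) =
      subst (n ≤ᵥ_) (sym (D-suc-suc s 2m+1≡))
        (≤ᵥ-+ (congruent (suc s)) (≤ᵥ-* (≤ᵥ-powℚ*term n-1 c 2c+1<p^n) (congruent s)))

    congruent-steps-p∤ : ∀ r {m c} → (∀ i → i < r → ¬ p ∣ suc (2 * (m + i))) →
                         (∀ s → 0 ≤ᵥ β s ℚ.* E s c) → Congruent m c → Congruent (m + r) c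
    congruent-steps-p∤ zero    {m} {c} _  _           congruent =
      subst (λ m′ → Congruent m′ c) (sym (ℕ.+-identityʳ m)) congruent
    congruent-steps-p∤ (suc r) {m} {c} p∤ βE-integral congruent =
      subst (λ m′ → Congruent m′ c) (sym (ℕ.+-suc m r))
        (congruent-steps-p∤ r p∤′ βE-integral (congruent-step-p∤ p∤₀ βE-integral congruent))
      where
      p∤₀ : ¬ p ∣ suc (2 * m)
      p∤₀ = subst (λ i → ¬ p ∣ suc (2 * i)) (ℕ.+-identityʳ m) (p∤ 0 ℕ.z<s)
      p∤′ : ∀ i → i < r → ¬ p ∣ suc (2 * (suc m + i))
      p∤′ i i<r = subst (λ j → ¬ p ∣ suc (2 * j)) (ℕ.+-suc m i) (p∤ (suc i) (s≤s i<r))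

    congruent-0-0 : Congruent 0 0
    congruent-0-0 zero    = congruent-order-0 0 0
    congruent-0-0 (suc s) = subst (n ≤ᵥ_) (sym (vanish (α (suc s)) (β (suc s)))) ≤ᵥ-0ℚ
      where
      open +-*-Solver
      vanish : ∀ x y → x ℚ.* 0ℚ ℚ.- y ℚ.* 0ℚ ≡ 0ℚ
      vanish = solve 2 (λ x y → x :* con 0ℚ :- y :* con 0ℚ := con 0ℚ) refl

    -- The only odd multiple of p strictly between 2kp and 2(k+1)p is p(2k+1), reached at m = kp + h.
    congruent-block : ∀ h → p ≡ suc (2 * h) → ∀ k → 2 * suc k < p ^ n →
                      Congruent (k * p) k → Congruent (suc k * p) (suc k)
    congruent-block h p≡ k 2[k+1]<p^n congruent =
      subst (λ m → Congruent m (suc k)) end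
        (congruent-steps-p∤ h after (≤ᵥ-βE (suc k) 2[k+1]<p^n)
          (congruent-step-p∣ middle 2k+1<p^n
            (congruent-steps-p∤ h before (≤ᵥ-βE k 2k<p^n) congruent)))
      where
      2k+1<p^n : suc (2 * k) < p ^ n
      2k+1<p^n = ℕ.<-trans (ℕ.n<1+n _) (subst (_< p ^ n) (ℕ.*-suc 2 k) 2[k+1]<p^n)
      2k<p^n : 2 * k < p ^ n
      2k<p^n = ℕ.<-trans (ℕ.n<1+n _) 2k+1<p^n
      shape-before : ∀ k p i → suc (2 * (k * p + i)) ≡ 2 * k * p + suc (2 * i)
      shape-before = solve-∀
      shape-middle : ∀ k h → suc (2 * (k * suc (2 * h) + h)) ≡ suc (2 * h) * suc (2 * k)
      shape-middle = solve-∀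
      shape-after : ∀ k h i →
                    suc (2 * (suc (k * suc (2 * h) + h) + i)) ≡ suc (2 * k) * suc (2 * h) + 2 * suc i
      shape-after = solve-∀
      shape-end : ∀ k h → suc (k * suc (2 * h) + h) + h ≡ suc k * suc (2 * h)
      shape-end = solve-∀
      before : ∀ i → i < h → ¬ p ∣ suc (2 * (k * p + i))
      before i i<h = subst (λ x → ¬ p ∣ x) (sym (shape-before k p i))
        (p∤a*p+x (2 * k) (suc (2 * i)) (subst (suc (2 * i) <_) (sym p≡) (s≤s (ℕ.*-monoʳ-< 2 i<h))))
      middle : suc (2 * (k * p + h)) ≡ p * suc (2 * k)
      middle = subst (λ q → suc (2 * (k * q + h)) ≡ q * suc (2 * k)) (sym p≡) (shape-middle k h)
      after : ∀ i → i < h → ¬ p ∣ suc (2 * (suc (k * p + h) + i))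
      after i i<h = subst (λ x → ¬ p ∣ x)
        (subst (λ q → suc (2 * k) * q + 2 * suc i ≡ suc (2 * (suc (k * q + h) + i)))
               (sym p≡) (sym (shape-after k h i)))
        (p∤a*p+x (suc (2 * k)) (2 * suc i) (subst (2 * suc i <_) (sym p≡) (s≤s (ℕ.*-monoʳ-≤ 2 i<h))))
      end : suc (k * p + h) + h ≡ suc k * p
      end = subst (λ q → suc (k * q + h) + h ≡ suc k * q) (sym p≡) (shape-end k h)

    congruent-at-multiples : ∀ h → p ≡ suc (2 * h) → ∀ k → 2 * k < p ^ n → Congruent (k * p) k
    congruent-at-multiples h p≡ zero    _          = congruent-0-0
    congruent-at-multiples h p≡ (suc k) 2[k+1]<p^n = congruent-block h p≡ k 2[k+1]<p^n
      (congruent-at-multiples h p≡ k (ℕ.<-trans (ℕ.*-monoʳ-< 2 (ℕ.n<1+n k)) 2[k+1]<p^n))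

lemma3p15 : (p s n k : ℕ) → Prime p → ¬ (p ≡ 2) → 1 ≤ s → 1 ≤ n →
    k ≤ (p ^ n ∸ 1) / 2 →
    (powℚ p (2 * s * n) Data.Rational.* Zeven s (k * p))
      ≡ (powℚ p (2 * s * (n ∸ 1)) Data.Rational.* Zeven s k) [modpow p ^ n ]
lemma3p15 p s zero      k _       _   _ ()  _
lemma3p15 p s (suc n-1) k p-prime p≢2 _ _ k≤ with prime≢2⇒odd p-prime p≢2
... | h , p≡ = ≤ᵥ⇒p^m∣↥×p∤↧
  (subst (suc n-1 ≤ᵥ_) (sym (sign-linear s (α s) (β s) (E s (k * p)) (E s k)))
         (≤ᵥ-sign s (congruent-at-multiples h p≡ k 2k<p^n s)))
  where
  open PAdic p p-prime
  open Recurrence.Scaled p p-prime n-1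
  2k<p^n : 2 * k < p ^ suc n-1
  2k<p^n = m≤[n∸1]/2⇒2m<n {{ℕ.m^n≢0 p (suc n-1)}} k≤
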